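{- The functor $\downarrow:\mathrm{Int}(\mathbf{Rel})\to\mathbf{Pos}$ is right adjoint to the forgetful functor $|\cdot|:\mathbf{Pos}\to\mathrm{Int}(\mathbf{Rel})$, and the functor $\uparrow:\mathrm{Int}(\mathbf{Rel})\to\mathbf{Neg}$ is left adjoint to the forgetful functor $|\cdot|:\mathbf{Neg}\to\mathrm{Int}(\mathbf{Rel})$; i.e., there are natural bijections $$\mathbf{Pos}\big((A^+_{\mathrm{mp}(A^+)},A^-_{\mathrm{mp}(A^-)}),\downarrow(B^+,B^-)\big)\cong\mathrm{Int}(\mathbf{Rel})\big((A^+,A^-),(B^+,B^-)\big)\cong\mathbf{Neg}\big(\uparrow(A^+,A^-),(B^+_{\mathrm{mp}(B^+)},B^-_{\mathrm{mp}(B^-)})\big).$$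
   Context: $\mathbf{Rel}$ is the category of sets and binary relations; relational composition written right to left, $R^*=\bigcup_{n\ge0}R^n$, and $R[X]=\{y\mid\exists a\in X,(a,y)\in R\}$, $[Y]R=\{x\mid\exists b\in Y,(x,b)\in R\}$. $\mathrm{Int}(\mathbf{Rel})$: objects pairs of sets $(A^+,A^-)$; a morphism $R:(A^+,A^-)\to(B^+,B^-)$ is a relation $A^++B^-\to B^++A^-$ ($+$ = disjoint union), equivalently relations $R_{12}:A^+\to B^+$, $R_{11}:A^+\to A^-$, $R_{21}:B^-\to A^-$, $R_{22}:B^-\to B^+$; identity: $R_{12}=\mathrm{Id}$, $R_{21}=\mathrm{Id}$, $R_{11}=R_{22}=\emptyset$; composite with $S:(B^+,B^-)\to(C^+,C^-)$: $(SR)_{12}=S_{12}(R_{22}S_{11})^*R_{12}$, $(SR)_{22}=S_{22}\cup S_{12}R_{22}(S_{11}R_{22})^*S_{21}$, $(SR)_{11}=R_{11}\cup R_{21}S_{11}(R_{22}S_{11})^*R_{12}$, $(SR)_{21}=R_{21}(S_{11}R_{22})^*S_{21}$. $\mathbf{Pos}$ and $\mathbf{Neg}$ both have objects $(A^+_{\mathrm{mp}(A^+)},A^-_{\mathrm{mp}(A^-)})$ with $(A^+,A^-)$ in $\mathrm{Int}(\mathbf{Rel})$ and subsets $\mathrm{mp}(A^\pm)\subseteq A^\pm$, with identities and composition of $\mathrm{Int}(\mathbf{Rel})$. A $\mathbf{Pos}$-morphism to $(B^+_{\mathrm{mp}(B^+)},B^-_{\mathrm{mp}(B^-)})$ is an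 $\mathrm{Int}(\mathbf{Rel})$-morphism $R$ with $[\mathrm{mp}(B^+)]R_{12}=\mathrm{mp}(A^+)$, $R_{21}[\mathrm{mp}(B^-)]=\mathrm{mp}(A^-)$, $[\mathrm{mp}(B^+)]R_{22}=\emptyset=R_{22}[\mathrm{mp}(B^-)]$. A $\mathbf{Neg}$-morphism is an $\mathrm{Int}(\mathbf{Rel})$-morphism $R$ with $R_{12}[\mathrm{mp}(A^+)]=\mathrm{mp}(B^+)$, $[\mathrm{mp}(A^-)]R_{21}=\mathrm{mp}(B^-)$, $[\mathrm{mp}(A^-)]R_{11}=\emptyset=R_{11}[\mathrm{mp}(A^+)]$. The forgetful functors send $(A^+_{\mathrm{mp}(A^+)},A^-_{\mathrm{mp}(A^-)})\mapsto(A^+,A^-)$ and $R\mapsto R$. Let $1=\{\star\}$. The functors $\downarrow:\mathrm{Int}(\mathbf{Rel})\to\mathbf{Pos}$ and $\uparrow:\mathrm{Int}(\mathbf{Rel})\to\mathbf{Neg}$ are given on objects by $\downarrow(A^+,A^-)=\uparrow(A^+,A^-)=((A^++1)_{1},(A^-+1)_{1})$, where the chosen subset of $A^\pm+1$ is $1=\{\star\}$; on a morphism $R$, $\downarrow R=\uparrow R$ is the relation with components $(\downarrow R)_{12}=R_{12}\cup\{(\star,\star)\}:A^++1\to B^++1$, $(\downarrow R)_{21}=R_{21}\cup\{(\star,\star)\}:B^-+1\to A^-+1$, $(\downarrow R)_{11}=R_{11}$, $(\downarrow R)_{22}=R_{22}$. -}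

module Defs where

open import Level using (0ℓ) renaming (suc to lsuc)
open import Data.Product using (Σ; ∃; _×_; _,_; proj₁; proj₂)
open import Data.Sum using (_⊎_; inj₁; inj₂)
open import Data.Unit using (⊤; tt)
open import Data.Empty using (⊥)
open import Function using (id)
open import Relation.Unary using (Pred; _≐_; ∅; ｛_｝)
open import Relation.Binary.PropositionalEquality using (_≡_)
open import Relation.Binary.Construct.Closure.ReflexiveTransitive using (Star)
open import Relation.Binary.Bundles using (Setoid)
open import Relation.Binary.Structures using (IsEquivalence)

Relʳ : Set → Set → Set₁
Relʳ A B = A → B → Set

-- relational composition, written right to left: (S ⊙ R) = "first R, then S"
_⊙_ : {A B C : Set} → Relʳ B C → Relʳ A B → Relʳ A C
(S ⊙ R) a c = ∃ λ b → R a b × S b c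
infixr 9 _⊙_

_∪ʳ_ : {A B : Set} → Relʳ A B → Relʳ A B → Relʳ A B
(R ∪ʳ S) a b = R a b ⊎ S a b
infixr 6 _∪ʳ_

_* : {A : Set} → Relʳ A A → Relʳ A A
R * = Star R

_≈ʳ_ : {A B : Set} → Relʳ A B → Relʳ A B → Set
R ≈ʳ S = ∀ a b → (R a b → S a b) × (S a b → R a b)

_[_] : {A B : Set} → Relʳ A B → Pred A 0ℓ → Pred B 0ℓ
(R [ X ]) y = ∃ λ a → X a × R a y

[_]_ : {A B : Set} → Pred B 0ℓ → Relʳ A B → Pred A 0ℓ
([ Y ] R) x = ∃ λ b → Y b × R x b

record Obj : Set₁ where
  constructor ⟨_,_⟩
  field
    pos : Set
    neg : Set
open Obj public

record Hom (A B : Obj) : Set₁ where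
  constructor hom
  field
    r12 : Relʳ (pos A) (pos B)
    r11 : Relʳ (pos A) (neg A)
    r21 : Relʳ (neg B) (neg A)
    r22 : Relʳ (neg B) (pos B)
open Hom public

idHom : (A : Obj) → Hom A A
idHom A = hom _≡_ (λ _ _ → ⊥) _≡_ (λ _ _ → ⊥)

_∘H_ : {A B C : Obj} → Hom B C → Hom A B → Hom A C
S ∘H R = hom
  (r12 S ⊙ (((r22 R ⊙ r11 S) *) ⊙ r12 R))
  (r11 R ∪ʳ (r21 R ⊙ r11 S ⊙ ((r22 R ⊙ r11 S) *) ⊙ r12 R))
  (r21 R ⊙ ((r11 S ⊙ r22 R) *) ⊙ r21 S)
  (r22 S ∪ʳ (r12 S ⊙ r22 R ⊙ ((r11 S ⊙ r22 R) *) ⊙ r21 S))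
infixr 9 _∘H_

_≈H_ : {A B : Obj} → Hom A B → Hom A B → Set
R ≈H S = (r12 R ≈ʳ r12 S) × (r11 R ≈ʳ r11 S) × (r21 R ≈ʳ r21 S) × (r22 R ≈ʳ r22 S)

≈ʳ-isEquivalence : {A B : Set} → IsEquivalence (_≈ʳ_ {A} {B})
≈ʳ-isEquivalence = record
  { refl = λ a b → id , id
  ; sym = λ p a b → proj₂ (p a b) , proj₁ (p a b)
  ; trans = λ p q a b → (λ x → proj₁ (q a b) (proj₁ (p a b) x))
                      , (λ x → proj₂ (p a b) (proj₂ (q a b) x))
  }

private
  module E {A B : Set} = IsEquivalence (≈ʳ-isEquivalence {A} {B})

≈H-isEquivalence : {A B : Obj} → IsEquivalence (_≈H_ {A} {B})
≈H-isEquivalence = record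
  { refl = E.refl , E.refl , E.refl , E.refl
  ; sym = λ { (p , q , r , s) → E.sym p , E.sym q , E.sym r , E.sym s }
  ; trans = λ { (p , q , r , s) (p' , q' , r' , s') →
                E.trans p p' , E.trans q q' , E.trans r r' , E.trans s s' }
  }

IntHomS : Obj → Obj → Setoid (lsuc 0ℓ) 0ℓ
IntHomS A B = record
  { Carrier = Hom A B ; _≈_ = _≈H_ ; isEquivalence = ≈H-isEquivalence }

record MObj : Set₁ where
  field
    obj : Obj
    mp⁺ : Pred (pos obj) 0ℓ
    mp⁻ : Pred (neg obj) 0ℓ
open MObj public

∣_∣ : MObj → Obj
∣ A ∣ = obj A

IsPos : (A B : MObj) → Hom ∣ A ∣ ∣ B ∣ → Set
IsPos A B R =
  (([ mp⁺ B ] r12 R) ≐ mp⁺ A) ×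
  ((r21 R [ mp⁻ B ]) ≐ mp⁻ A) ×
  (([ mp⁺ B ] r22 R) ≐ ∅) ×
  ((r22 R [ mp⁻ B ]) ≐ ∅)

IsNeg : (A B : MObj) → Hom ∣ A ∣ ∣ B ∣ → Set
IsNeg A B R =
  ((r12 R [ mp⁺ A ]) ≐ mp⁺ B) ×
  (([ mp⁻ A ] r21 R) ≐ mp⁻ B) ×
  (([ mp⁻ A ] r11 R) ≐ ∅) ×
  ((r11 R [ mp⁺ A ]) ≐ ∅)

PosHom : MObj → MObj → Set₁
PosHom A B = Σ (Hom ∣ A ∣ ∣ B ∣) (IsPos A B)

NegHom : MObj → MObj → Set₁
NegHom A B = Σ (Hom ∣ A ∣ ∣ B ∣) (IsNeg A B)

PosHomS : MObj → MObj → Setoid (lsuc 0ℓ) 0ℓ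
PosHomS A B = record
  { Carrier = PosHom A B
  ; _≈_ = λ R S → proj₁ R ≈H proj₁ S
  ; isEquivalence = record
      { refl = IsEquivalence.refl ≈H-isEquivalence
      ; sym = IsEquivalence.sym ≈H-isEquivalence
      ; trans = IsEquivalence.trans ≈H-isEquivalence }
  }

NegHomS : MObj → MObj → Setoid (lsuc 0ℓ) 0ℓ
NegHomS A B = record
  { Carrier = NegHom A B
  ; _≈_ = λ R S → proj₁ R ≈H proj₁ S
  ; isEquivalence = record
      { refl = IsEquivalence.refl ≈H-isEquivalence
      ; sym = IsEquivalence.sym ≈H-isEquivalence
      ; trans = IsEquivalence.trans ≈H-isEquivalence }
  }

⋆ : {A : Set} → A ⊎ ⊤
⋆ = inj₂ tt

liftʳ : {A B : Set} → Relʳ A B → Relʳ (A ⊎ ⊤) (B ⊎ ⊤)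
liftʳ R (inj₁ a) (inj₁ b) = R a b
liftʳ R (inj₁ a) (inj₂ _) = ⊥
liftʳ R (inj₂ _) _        = ⊥

⋆⋆ : {A B : Set} → Relʳ (A ⊎ ⊤) (B ⊎ ⊤)
⋆⋆ x y = (x ≡ ⋆) × (y ≡ ⋆)

↓ : Obj → MObj
↓ A = record
  { obj = ⟨ pos A ⊎ ⊤ , neg A ⊎ ⊤ ⟩
  ; mp⁺ = ｛ ⋆ ｝
  ; mp⁻ = ｛ ⋆ ｝
  }

↑ : Obj → MObj
↑ A = record
  { obj = ⟨ pos A ⊎ ⊤ , neg A ⊎ ⊤ ⟩
  ; mp⁺ = ｛ ⋆ ｝
  ; mp⁻ = ｛ ⋆ ｝
  }

↓Hom : {A B : Obj} → Hom A B → Hom ∣ ↓ A ∣ ∣ ↓ B ∣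
↓Hom R = hom (liftʳ (r12 R) ∪ʳ ⋆⋆) (liftʳ (r11 R))
             (liftʳ (r21 R) ∪ʳ ⋆⋆) (liftʳ (r22 R))

↑Hom : {A B : Obj} → Hom A B → Hom ∣ ↑ A ∣ ∣ ↑ B ∣
↑Hom R = hom (liftʳ (r12 R) ∪ʳ ⋆⋆) (liftʳ (r11 R))
             (liftʳ (r21 R) ∪ʳ ⋆⋆) (liftʳ (r22 R))

-- A Pos-morphism R : A → ↓B is determined by its restriction to B: the Pos conditions force R
-- to reach ⋆ exactly from mp(A⁺), to leave ⋆ exactly towards mp(A⁻), and to keep ⋆ out of R₂₂.
-- Conversely every k : |A| → B extends in this way, which gives the bijection. Naturality in B
-- comes down to restrict (↓g ∘ Z) = g ∘ restrict Z: as Z₂₂ avoids ⋆, the feedback loops of the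
-- composite never pass through ⋆. The Neg half is the Pos half seen through the duality
-- (A⁺, A⁻) ↦ (A⁻, A⁺), which reverses composition and turns ↑ into ↓.
module Submission where

open import Defs
open import Data.Empty using (⊥-elim)
open import Data.Product using (Σ; ∃; _×_; _,_; proj₁; proj₂)
open import Data.Sum using (_⊎_; inj₁; inj₂)
open import Data.Unit using (⊤)
open import Function using (id)
open import Function.Bundles using (Inverse)
import Function.Construct.Composition as Compose
import Function.Construct.Symmetry as Symmetry
import Relation.Binary.Reasoning.Setoid as SetoidReasoning
open import Level using (0ℓ)
open import Relation.Binary.Construct.Closure.ReflexiveTransitive using (Star; ε; _◅_; gmap)
open import Relation.Binary.PropositionalEquality using (_≡_; refl)
open import Relation.Binary.Structures using (IsEquivalence)
open import Relation.Nullary using (¬_)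
open import Relation.Unary using (Pred; _⊆_; ∅; ｛_｝)

module _ {X : Set} {R : Relʳ X X} {P : Pred X 0ℓ} where

  Star-noStepInto⇒≡ : (∀ {x y} → R x y → ¬ P y) → ∀ {x y} → Star R x y → P y → x ≡ y
  Star-noStepInto⇒≡ noStep ε        _  = refl
  Star-noStepInto⇒≡ noStep (r ◅ rs) py with Star-noStepInto⇒≡ noStep rs py
  ... | refl = ⊥-elim (noStep r py)

  Star-noStepOutOf⇒≡ : (∀ {x y} → R x y → ¬ P x) → ∀ {x y} → Star R x y → P x → x ≡ y
  Star-noStepOutOf⇒≡ noStep ε       _  = refl
  Star-noStepOutOf⇒≡ noStep (r ◅ _) px = ⊥-elim (noStep r px)

module _ {X : Set} {Q : Relʳ (X ⊎ ⊤) (X ⊎ ⊤)} {Q′ : Relʳ X X}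
         (Q⊆liftQ′ : ∀ x y → Q x y → liftʳ Q′ x y) where

  Star-fromInj₁ : ∀ {a y} → Star Q (inj₁ a) y → ∃ λ b → y ≡ inj₁ b × Star Q′ a b
  Star-fromInj₁ ε = _ , refl , ε
  Star-fromInj₁ (_◅_ {j = inj₁ _} q qs) with Star-fromInj₁ qs
  ... | b , refl , q′s = b , refl , Q⊆liftQ′ _ _ q ◅ q′s
  Star-fromInj₁ (_◅_ {j = inj₂ _} q _) = ⊥-elim (Q⊆liftQ′ _ _ q)

  Star-intoInj₁ : ∀ {x b} → Star Q x (inj₁ b) → ∃ λ a → x ≡ inj₁ a × Star Q′ a b
  Star-intoInj₁ ε = _ , refl , ε
  Star-intoInj₁ {inj₁ a} (q ◅ qs) with Star-intoInj₁ qs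
  ... | _ , refl , q′s = a , refl , Q⊆liftQ′ _ _ q ◅ q′s
  Star-intoInj₁ {inj₂ _} (q ◅ _) = ⊥-elim (Q⊆liftQ′ _ _ q)

liftʳ-cong : {X Y : Set} {R S : Relʳ X Y} → R ≈ʳ S → liftʳ R ≈ʳ liftʳ S
liftʳ-cong e (inj₁ a) (inj₁ b) = e a b
liftʳ-cong e (inj₁ a) (inj₂ _) = id , id
liftʳ-cong e (inj₂ _) _        = id , id

module ≈H {A B : Obj} = IsEquivalence (≈H-isEquivalence {A} {B})

infix 4 _⊆H_
_⊆H_ : {A B : Obj} → Hom A B → Hom A B → Set
R ⊆H S = (∀ a b → r12 R a b → r12 S a b) × (∀ a b → r11 R a b → r11 S a b)
       × (∀ a b → r21 R a b → r21 S a b) × (∀ a b → r22 R a b → r22 S a b)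

⊆H-antisym : {A B : Obj} {R S : Hom A B} → R ⊆H S → S ⊆H R → R ≈H S
⊆H-antisym (i12 , i11 , i21 , i22) (j12 , j11 , j21 , j22) =
    (λ a b → i12 a b , j12 a b) , (λ a b → i11 a b , j11 a b)
  , (λ a b → i21 a b , j21 a b) , (λ a b → i22 a b , j22 a b)

∘-monoʳ : {A B C : Obj} (S : Hom B C) {R R′ : Hom A B} → R ⊆H R′ → (S ∘H R) ⊆H (S ∘H R′)
∘-monoʳ S {R} {R′} (i12 , i11 , i21 , i22) =
    (λ { _ _ (b , (b₀ , r , loop) , s) → b , (b₀ , i12 _ _ r , gmap id loop⁺ loop) , s })
  , (λ { _ _ (inj₁ r) → inj₁ (i11 _ _ r)
       ; _ _ (inj₂ (n , (y₂ , (y₁ , r , loop) , s) , r′)) →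
           inj₂ (n , (y₂ , (y₁ , i12 _ _ r , gmap id loop⁺ loop) , s) , i21 _ _ r′) })
  , (λ { _ _ (n , (m , s , loop) , r) → n , (m , s , gmap id loop⁻ loop) , i21 _ _ r })
  , (λ { _ _ (inj₁ s) → inj₁ s
       ; _ _ (inj₂ (y₃ , (y₂ , (y₁ , s , loop) , r) , s′)) →
           inj₂ (y₃ , (y₂ , (y₁ , s , gmap id loop⁻ loop) , i22 _ _ r) , s′) })
  where
  loop⁺ : ∀ {x y} → (r22 R ⊙ r11 S) x y → (r22 R′ ⊙ r11 S) x y
  loop⁺ (w , s , r) = w , s , i22 _ _ r
  loop⁻ : ∀ {x y} → (r11 S ⊙ r22 R) x y → (r11 S ⊙ r22 R′) x y
  loop⁻ (w , r , s) = w , i22 _ _ r , s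

≈H⇒⊆H : {A B : Obj} {R S : Hom A B} → R ≈H S → R ⊆H S
≈H⇒⊆H (e12 , e11 , e21 , e22) =
    (λ a b → proj₁ (e12 a b)) , (λ a b → proj₁ (e11 a b))
  , (λ a b → proj₁ (e21 a b)) , (λ a b → proj₁ (e22 a b))

∘-congʳ : {A B C : Obj} (S : Hom B C) {R R′ : Hom A B} → R ≈H R′ → (S ∘H R) ≈H (S ∘H R′)
∘-congʳ S e = ⊆H-antisym (∘-monoʳ S (≈H⇒⊆H e)) (∘-monoʳ S (≈H⇒⊆H (≈H.sym e)))

-- op is a strict involution, and contravariant on the nose: opHom (S ∘H R) and
-- opHom R ∘H opHom S are definitionally equal, as are opHom (↑Hom R) and ↓Hom (opHom R).
op : Obj → Obj
op A = ⟨ neg A , pos A ⟩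

opHom : {A B : Obj} → Hom A B → Hom (op B) (op A)
opHom R = hom (r21 R) (r22 R) (r12 R) (r11 R)

opMObj : MObj → MObj
opMObj A = record { obj = op ∣ A ∣ ; mp⁺ = mp⁻ A ; mp⁻ = mp⁺ A }

opHom-cong : {A B : Obj} {R S : Hom A B} → R ≈H S → opHom R ≈H opHom S
opHom-cong (e12 , e11 , e21 , e22) = e21 , e22 , e12 , e11

IsPos⇒IsNeg-op : {A B : MObj} {R : Hom ∣ A ∣ ∣ B ∣} →
                 IsPos A B R → IsNeg (opMObj B) (opMObj A) (opHom R)
IsPos⇒IsNeg-op (p12 , p21 , p22) = p21 , p12 , p22

IsNeg⇒IsPos-op : {A B : MObj} {R : Hom ∣ A ∣ ∣ B ∣} →
                 IsNeg A B R → IsPos (opMObj B) (opMObj A) (opHom R)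
IsNeg⇒IsPos-op (n12 , n21 , n11) = n21 , n12 , n11

∘-congˡ : {A B C : Obj} {S S′ : Hom B C} (R : Hom A B) → S ≈H S′ → (S ∘H R) ≈H (S′ ∘H R)
∘-congˡ R e = opHom-cong (∘-congʳ (opHom R) (opHom-cong e))

opHom-inverse : (A B : Obj) → Inverse (IntHomS A B) (IntHomS (op B) (op A))
opHom-inverse A B = record
  { to = opHom ; from = opHom ; to-cong = opHom-cong ; from-cong = opHom-cong
  ; inverse = opHom-cong , opHom-cong }

opHom-Pos⇔Neg : (A B : MObj) → Inverse (PosHomS A B) (NegHomS (opMObj B) (opMObj A))
opHom-Pos⇔Neg A B = record
  { to = λ { (R , R-pos) → opHom R , IsPos⇒IsNeg-op {A} {B} {R} R-pos }
  ; from = λ { (R , R-neg) → opHom R , IsNeg⇒IsPos-op {opMObj B} {opMObj A} {R} R-neg }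
  ; to-cong = opHom-cong ; from-cong = opHom-cong
  ; inverse = opHom-cong , opHom-cong }

IsPos-∘ : {A B C : MObj} (S : Hom ∣ B ∣ ∣ C ∣) (R : Hom ∣ A ∣ ∣ B ∣) →
          IsPos B C S → IsPos A B R → IsPos A C (S ∘H R)
IsPos-∘ {A} {B} {C} S R (S12 , S21 , (S-no-into , _) , (S-no-from , _))
                            (R12 , R21 , (R-no-into , _) , (R-no-from , _)) =
  (into⁺ , from⁺) , (into⁻ , from⁻) , (no-into , λ ()) , (no-from , λ ())
  where
  -- the feedback loops through B never touch mp(B), since R₂₂ avoids it
  noStepInto : ∀ {x y} → (r22 R ⊙ r11 S) x y → ¬ mp⁺ B y
  noStepInto (_ , _ , r) my = R-no-into (_ , my , r)
  noStepOutOf : ∀ {x y} → (r11 S ⊙ r22 R) x y → ¬ mp⁻ B x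
  noStepOutOf (_ , r , _) mx = R-no-from (_ , mx , r)

  into⁺ : [ mp⁺ C ] r12 (S ∘H R) ⊆ mp⁺ A
  into⁺ (c , mc , b , (_ , r , loop) , s)
    with refl ← Star-noStepInto⇒≡ noStepInto loop (proj₁ S12 (c , mc , s))
    = proj₁ R12 (b , proj₁ S12 (c , mc , s) , r)

  from⁺ : mp⁺ A ⊆ [ mp⁺ C ] r12 (S ∘H R)
  from⁺ ma = let b , mb , r = proj₂ R12 ma ; c , mc , s = proj₂ S12 mb in
             c , mc , b , (b , r , ε) , s

  into⁻ : r21 (S ∘H R) [ mp⁻ C ] ⊆ mp⁻ A
  into⁻ (c , mc , _ , (b , s , loop) , r)
    with refl ← Star-noStepOutOf⇒≡ noStepOutOf loop (proj₁ S21 (c , mc , s))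
    = proj₁ R21 (b , proj₁ S21 (c , mc , s) , r)

  from⁻ : mp⁻ A ⊆ r21 (S ∘H R) [ mp⁻ C ]
  from⁻ ma = let b , mb , r = proj₂ R21 ma ; c , mc , s = proj₂ S21 mb in
             c , mc , b , (b , s , ε) , r

  no-into : [ mp⁺ C ] r22 (S ∘H R) ⊆ ∅
  no-into (c , mc , inj₁ s) = S-no-into (c , mc , s)
  no-into (c , mc , inj₂ (b , (_ , _ , r) , s)) = R-no-into (b , proj₁ S12 (c , mc , s) , r)

  no-from : r22 (S ∘H R) [ mp⁻ C ] ⊆ ∅
  no-from (c , mc , inj₁ s) = S-no-from (c , mc , s)
  no-from (c , mc , inj₂ (_ , (_ , (b , s , loop) , r) , _))
    with refl ← Star-noStepOutOf⇒≡ noStepOutOf loop (proj₁ S21 (c , mc , s))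
    = R-no-from (b , proj₁ S21 (c , mc , s) , r)

↓-isPos : {A B : Obj} (R : Hom A B) → IsPos (↓ A) (↓ B) (↓Hom R)
↓-isPos R = (into⁺ , λ { refl → ⋆ , refl , inj₂ (refl , refl) })
          , (into⁻ , λ { refl → ⋆ , refl , inj₂ (refl , refl) })
          , ((λ {x} → no-into {x}) , λ ()) , (no-from , λ ())
  where
  into⁺ : [ ｛ ⋆ ｝ ] r12 (↓Hom R) ⊆ ｛ ⋆ ｝
  into⁺ {inj₁ _} (_ , refl , inj₁ ())
  into⁺ {inj₁ _} (_ , refl , inj₂ (() , _))
  into⁺ {inj₂ _} _ = refl
  into⁻ : r21 (↓Hom R) [ ｛ ⋆ ｝ ] ⊆ ｛ ⋆ ｝
  into⁻ {inj₁ _} (_ , refl , inj₁ ())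
  into⁻ {inj₁ _} (_ , refl , inj₂ (_ , ()))
  into⁻ {inj₂ _} _ = refl
  no-into : [ ｛ ⋆ ｝ ] r22 (↓Hom R) ⊆ ∅
  no-into {inj₁ _} (_ , refl , ())
  no-into {inj₂ _} (_ , refl , ())
  no-from : r22 (↓Hom R) [ ｛ ⋆ ｝ ] ⊆ ∅
  no-from (_ , refl , ())

restrict : {A B : Obj} → Hom A ∣ ↓ B ∣ → Hom A B
restrict R = hom (λ a b → r12 R a (inj₁ b)) (r11 R) (λ b a → r21 R (inj₁ b) a)
                 (λ b b′ → r22 R (inj₁ b) (inj₁ b′))

extend : (A : MObj) {B : Obj} → Hom ∣ A ∣ B → Hom ∣ A ∣ ∣ ↓ B ∣
extend A {B} k = hom e12 (r11 k) e21 (liftʳ (r22 k))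
  where
  e12 : Relʳ (pos ∣ A ∣) (pos B ⊎ ⊤)
  e12 a (inj₁ b) = r12 k a b
  e12 a (inj₂ _) = mp⁺ A a
  e21 : Relʳ (neg B ⊎ ⊤) (neg ∣ A ∣)
  e21 (inj₁ b) a = r21 k b a
  e21 (inj₂ _) a = mp⁻ A a

extend-isPos : {A : MObj} {B : Obj} (k : Hom ∣ A ∣ B) → IsPos A (↓ B) (extend A k)
extend-isPos k =
    ((λ { (_ , refl , p) → p }) , λ p → ⋆ , refl , p)
  , ((λ { (_ , refl , p) → p }) , λ p → ⋆ , refl , p)
  , ((λ { {inj₁ _} (_ , refl , ()) ; {inj₂ _} (_ , refl , ()) }) , λ ())
  , ((λ { (_ , refl , ()) }) , λ ())

restrict-cong : {A B : Obj} {R S : Hom A ∣ ↓ B ∣} → R ≈H S → restrict R ≈H restrict S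
restrict-cong (e12 , e11 , e21 , e22) =
  (λ a b → e12 a (inj₁ b)) , e11 , (λ b a → e21 (inj₁ b) a) , (λ b b′ → e22 (inj₁ b) (inj₁ b′))

extend-cong : {A : MObj} {B : Obj} {k l : Hom ∣ A ∣ B} → k ≈H l → extend A k ≈H extend A l
extend-cong (e12 , e11 , e21 , e22) =
    (λ { a (inj₁ b) → e12 a b ; a (inj₂ _) → id , id })
  , e11
  , (λ { (inj₁ b) a → e21 b a ; (inj₂ _) a → id , id })
  , liftʳ-cong e22

extend-restrict : {A : MObj} {B : Obj} {R : Hom ∣ A ∣ ∣ ↓ B ∣} → IsPos A (↓ B) R →
                  extend A (restrict R) ≈H R
extend-restrict {R = R} (R12 , R21 , (no⋆-into , _) , (no⋆-from , _)) =
    (λ { a (inj₁ b) → id , id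
       ; a (inj₂ _) → (λ m → at⋆₁₂ (proj₂ R12 m)) , (λ r → proj₁ R12 (⋆ , refl , r)) })
  , (λ a a′ → id , id)
  , (λ { (inj₁ b) a → id , id
       ; (inj₂ _) a → (λ m → at⋆₂₁ (proj₂ R21 m)) , (λ r → proj₁ R21 (⋆ , refl , r)) })
  , (λ { (inj₁ b) (inj₁ b′) → id , id
       ; (inj₁ b) (inj₂ _) → (λ ()) , (λ r → ⊥-elim (no⋆-into (⋆ , refl , r)))
       ; (inj₂ _) y → (λ ()) , (λ r → ⊥-elim (no⋆-from (⋆ , refl , r))) })
  where
  at⋆₁₂ : ∀ {a} → ([ ｛ ⋆ ｝ ] r12 R) a → r12 R a ⋆
  at⋆₁₂ (_ , refl , r) = r
  at⋆₂₁ : ∀ {a} → (r21 R [ ｛ ⋆ ｝ ]) a → r21 R ⋆ a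
  at⋆₂₁ (_ , refl , r) = r

Pos-adjunction : (A : MObj) (B : Obj) → Inverse (PosHomS A (↓ B)) (IntHomS ∣ A ∣ B)
Pos-adjunction A B = record
  { to        = λ R → restrict (proj₁ R)
  ; from      = λ k → extend A k , extend-isPos k
  ; to-cong   = restrict-cong
  ; from-cong = extend-cong
  ; inverse   = restrict-cong
              , λ {R} e → ≈H.trans (extend-cong e) (extend-restrict (proj₂ R))
  }

∘-restrict-⊆ : {A B C : Obj} (g : Hom B C) (Z : Hom A ∣ ↓ B ∣) →
               (g ∘H restrict Z) ⊆H restrict (↓Hom g ∘H Z)
∘-restrict-⊆ g Z =
    (λ { _ _ (b , (b₀ , z , loop) , gb) → inj₁ b , (inj₁ b₀ , z , gmap inj₁ loop⁺ loop) , inj₁ gb })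
  , (λ { _ _ (inj₁ z) → inj₁ z
       ; _ _ (inj₂ (n , (y₂ , (y₁ , z , loop) , gy) , z′)) →
           inj₂ (inj₁ n , (inj₁ y₂ , (inj₁ y₁ , z , gmap inj₁ loop⁺ loop) , gy) , z′) })
  , (λ { _ _ (n , (m , gm , loop) , z) → inj₁ n , (inj₁ m , inj₁ gm , gmap inj₁ loop⁻ loop) , z })
  , (λ { _ _ (inj₁ gc) → inj₁ gc
       ; _ _ (inj₂ (y₃ , (y₂ , (y₁ , gy₁ , loop) , z) , gy₃)) →
           inj₂ (inj₁ y₃ , (inj₁ y₂ , (inj₁ y₁ , inj₁ gy₁ , gmap inj₁ loop⁻ loop) , z) , inj₁ gy₃) })
  where
  loop⁺ : ∀ {a b} → (r22 (restrict Z) ⊙ r11 g) a b → (r22 Z ⊙ liftʳ (r11 g)) (inj₁ a) (inj₁ b)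
  loop⁺ (w , gw , zw) = inj₁ w , gw , zw
  loop⁻ : ∀ {a b} → (r11 g ⊙ r22 (restrict Z)) a b → (liftʳ (r11 g) ⊙ r22 Z) (inj₁ a) (inj₁ b)
  loop⁻ (w , zw , gw) = inj₁ w , zw , gw

restrict-↓∘-⊆ : {A : MObj} {B C : Obj} (g : Hom B C) {Z : Hom ∣ A ∣ ∣ ↓ B ∣} → IsPos A (↓ B) Z →
                restrict (↓Hom g ∘H Z) ⊆H (g ∘H restrict Z)
restrict-↓∘-⊆ g {Z} (_ , _ , (no⋆-into , _) , (no⋆-from , _)) = ⊆₁₂ , ⊆₁₁ , ⊆₂₁ , ⊆₂₂
  where
  -- as Z₂₂ avoids ⋆, the feedback loops of ↓g ∘ Z stay inside B
  loop⁺⊆ : ∀ x y → (r22 Z ⊙ liftʳ (r11 g)) x y → liftʳ (r22 (restrict Z) ⊙ r11 g) x y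
  loop⁺⊆ (inj₁ _) (inj₁ _) (inj₁ w , gw , zw) = w , gw , zw
  loop⁺⊆ (inj₁ _) (inj₂ _) (inj₁ w , _ , zw) = no⋆-into (⋆ , refl , zw)
  loop⁺⊆ (inj₁ _) _        (inj₂ _ , () , _)
  loop⁺⊆ (inj₂ _) _        (_ , () , _)
  loop⁻⊆ : ∀ x y → (liftʳ (r11 g) ⊙ r22 Z) x y → liftʳ (r11 g ⊙ r22 (restrict Z)) x y
  loop⁻⊆ (inj₂ _) _        (_ , zw , _) = no⋆-from (⋆ , refl , zw)
  loop⁻⊆ (inj₁ _) (inj₁ _) (inj₁ w , zw , gw) = w , zw , gw
  loop⁻⊆ (inj₁ _) (inj₂ _) (inj₁ w , _ , ())
  loop⁻⊆ (inj₁ _) _        (inj₂ _ , _ , ())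

  Y = ↓Hom g ∘H Z
  Z′ = restrict Z

  ⊆₁₂ : ∀ a c → r12 (restrict Y) a c → r12 (g ∘H Z′) a c
  ⊆₁₂ _ _ (inj₁ b , (_ , z , loop) , inj₁ gb) with Star-intoInj₁ loop⁺⊆ loop
  ... | _ , refl , loop′ = b , (_ , z , loop′) , gb
  ⊆₁₂ _ _ (inj₂ _ , _ , inj₁ ())
  ⊆₁₂ _ _ (_ , _ , inj₂ (_ , ()))

  ⊆₁₁ : ∀ a a′ → r11 (restrict Y) a a′ → r11 (g ∘H Z′) a a′
  ⊆₁₁ _ _ (inj₁ z) = inj₁ z
  ⊆₁₁ _ _ (inj₂ (inj₁ n , (inj₁ b , (_ , z , loop) , gb) , z′)) with Star-intoInj₁ loop⁺⊆ loop
  ... | _ , refl , loop′ = inj₂ (n , (b , (_ , z , loop′) , gb) , z′)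
  ⊆₁₁ _ _ (inj₂ (inj₂ _ , (inj₁ _ , _ , ()) , _))
  ⊆₁₁ _ _ (inj₂ (_ , (inj₂ _ , _ , ()) , _))

  ⊆₂₁ : ∀ c a → r21 (restrict Y) c a → r21 (g ∘H Z′) c a
  ⊆₂₁ _ _ (_ , (inj₁ b , inj₁ gb , loop) , z) with Star-fromInj₁ loop⁻⊆ loop
  ... | _ , refl , loop′ = _ , (b , gb , loop′) , z
  ⊆₂₁ _ _ (_ , (inj₁ _ , inj₂ (_ , ()) , _) , _)
  ⊆₂₁ _ _ (_ , (inj₂ _ , inj₁ () , _) , _)
  ⊆₂₁ _ _ (_ , (inj₂ _ , inj₂ (() , _) , _) , _)

  ⊆₂₂ : ∀ c c′ → r22 (restrict Y) c c′ → r22 (g ∘H Z′) c c′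
  ⊆₂₂ _ _ (inj₁ gc) = inj₁ gc
  ⊆₂₂ _ _ (inj₂ (inj₁ b₃ , (_ , (inj₁ b₁ , inj₁ gb₁ , loop) , z) , inj₁ gb₃))
    with Star-fromInj₁ loop⁻⊆ loop
  ... | _ , refl , loop′ = inj₂ (b₃ , (_ , (b₁ , gb₁ , loop′) , z) , gb₃)
  ⊆₂₂ _ _ (inj₂ (_ , (_ , (inj₁ _ , inj₂ (_ , ()) , _) , _) , _))
  ⊆₂₂ _ _ (inj₂ (_ , (_ , (inj₂ _ , inj₁ () , _) , _) , _))
  ⊆₂₂ _ _ (inj₂ (_ , (_ , (inj₂ _ , inj₂ (() , _) , _) , _) , _))
  ⊆₂₂ _ _ (inj₂ (inj₂ _ , _ , inj₁ ()))
  ⊆₂₂ _ _ (inj₂ (_ , _ , inj₂ (_ , ())))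

restrict-↓∘ : {A : MObj} {B C : Obj} (g : Hom B C) {Z : Hom ∣ A ∣ ∣ ↓ B ∣} → IsPos A (↓ B) Z →
              restrict (↓Hom g ∘H Z) ≈H (g ∘H restrict Z)
restrict-↓∘ g {Z} Z-pos = ⊆H-antisym (restrict-↓∘-⊆ g Z-pos) (∘-restrict-⊆ g Z)

extend-natural : {A A′ : MObj} {B C : Obj} (f : PosHom A′ A) (g : Hom B C) (k : Hom ∣ A ∣ B) →
                 extend A′ (g ∘H k ∘H proj₁ f) ≈H (↓Hom g ∘H extend A k ∘H proj₁ f)
extend-natural {A} {A′} {B} {C} (f , f-pos) g k = begin
  extend A′ (g ∘H k ∘H f)             ≡⟨⟩
  extend A′ (g ∘H restrict Z)         ≈⟨ extend-cong (≈H.sym (restrict-↓∘ g Z-pos)) ⟩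
  extend A′ (restrict (↓Hom g ∘H Z))  ≈⟨ extend-restrict gZ-pos ⟩
  ↓Hom g ∘H Z                         ∎
  where
  open SetoidReasoning (IntHomS ∣ A′ ∣ ∣ ↓ C ∣)
  Z = extend A k ∘H f
  Z-pos : IsPos A′ (↓ B) Z
  Z-pos = IsPos-∘ (extend A k) f (extend-isPos k) f-pos
  gZ-pos : IsPos A′ (↓ C) (↓Hom g ∘H Z)
  gZ-pos = IsPos-∘ {A′} {↓ B} (↓Hom g) Z (↓-isPos g) Z-pos

-- Composition is associative only up to ≈H, so the bracketing that the Neg half dualises to
-- needs its own proof.
extend-natural′ : {A A′ : MObj} {B C : Obj} (f : PosHom A′ A) (g : Hom B C) (k : Hom ∣ A ∣ B) →
                  extend A′ ((g ∘H k) ∘H proj₁ f) ≈H ((↓Hom g ∘H extend A k) ∘H proj₁ f)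
extend-natural′ {A} {A′} {B} {C} (f , f-pos) g k = begin
  extend A′ ((g ∘H k) ∘H f)
    ≈⟨ extend-cong (∘-congˡ f (≈H.sym (restrict-↓∘ g (extend-isPos k)))) ⟩
  extend A′ (restrict gk ∘H f)    ≡⟨⟩
  extend A′ (restrict (gk ∘H f))  ≈⟨ extend-restrict gkf-pos ⟩
  gk ∘H f                         ∎
  where
  open SetoidReasoning (IntHomS ∣ A′ ∣ ∣ ↓ C ∣)
  gk = ↓Hom g ∘H extend A k
  gkf-pos : IsPos A′ (↓ C) (gk ∘H f)
  gkf-pos = IsPos-∘ gk f (IsPos-∘ {A} {↓ B} (↓Hom g) (extend A k) (↓-isPos g) (extend-isPos k)) f-pos

↑-isNeg : {A B : Obj} (R : Hom A B) → IsNeg (↑ A) (↑ B) (↑Hom R)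
↑-isNeg {A} {B} R = IsPos⇒IsNeg-op {↓ (op B)} {↓ (op A)} {↓Hom (opHom R)} (↓-isPos (opHom R))

Neg-adjunction : (A : Obj) (B : MObj) → Inverse (IntHomS A ∣ B ∣) (NegHomS (↑ A) B)
Neg-adjunction A B =
  Compose.inverse (opHom-inverse A ∣ B ∣)
    (Compose.inverse (Symmetry.inverse (Pos-adjunction (opMObj B) (op A)))
                     (opHom-Pos⇔Neg (opMObj B) (↓ (op A))))

Neg-adjunction-natural :
  {A A′ : Obj} {B B′ : MObj} (f : Hom A′ A) (g : NegHom B B′) (k : Hom A ∣ B ∣) →
  proj₁ (Inverse.to (Neg-adjunction A′ B′) (proj₁ g ∘H k ∘H f))
    ≈H (proj₁ g ∘H proj₁ (Inverse.to (Neg-adjunction A B) k) ∘H ↑Hom f)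
Neg-adjunction-natural {B = B} {B′} f (g , g-neg) k =
  opHom-cong (extend-natural′ (opHom g , IsNeg⇒IsPos-op {B} {B′} {g} g-neg) (opHom f) (opHom k))

mainTheorem13 :
      (∀ {A B : Obj} (R : Hom A B) → IsPos (↓ A) (↓ B) (↓Hom R))
    × (∀ {A B : Obj} (R : Hom A B) → IsNeg (↑ A) (↑ B) (↑Hom R))
    × (Σ ((A : MObj) (B : Obj) → Inverse (PosHomS A (↓ B)) (IntHomS ∣ A ∣ B)) λ φ →
         ∀ {A A' : MObj} {B B' : Obj}
           (f : PosHom A' A) (g : Hom B B') (k : Hom ∣ A ∣ B) →
           proj₁ (Inverse.from (φ A' B') (g ∘H k ∘H proj₁ f))
             ≈H (↓Hom g ∘H proj₁ (Inverse.from (φ A B) k) ∘H proj₁ f))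
    × (Σ ((A : Obj) (B : MObj) → Inverse (IntHomS A ∣ B ∣) (NegHomS (↑ A) B)) λ ψ →
         ∀ {A A' : Obj} {B B' : MObj}
           (f : Hom A' A) (g : NegHom B B') (k : Hom A ∣ B ∣) →
           proj₁ (Inverse.to (ψ A' B') (proj₁ g ∘H k ∘H f))
             ≈H (proj₁ g ∘H proj₁ (Inverse.to (ψ A B) k) ∘H ↑Hom f))
mainTheorem13 =
    ↓-isPos
  , ↑-isNeg
  , (Pos-adjunction , extend-natural)
  , (Neg-adjunction , Neg-adjunction-natural)
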